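{- Let $n\ge 3$ and $1\le k\le n-1$. The defect $k$ group of the cycle graph on $n$ vertices is isomorphic to the cyclic group $Z_{n-k}$.
   Context: For a finite simple undirected graph $\Gamma=(V,E)$, the flow semigroup $S_\Gamma$ is the semigroup of transformations of $V$ (acting on the right) generated by the elementary collapsings $e_{uv}$ and $e_{vu}$ for all edges $uv\in E$, where $e_{uv}$ maps $u$ to $v$ and fixes every other vertex. For $1\le k\le |V|-1$ and $V_k\subseteq V$ with $|V_k|=k$, the defect $k$ group $G_{k,V_k}$ is the permutation group on $V\setminus V_k$ generated by the restrictions $s|_{V\setminus V_k}$ of all $s\in S_\Gamma$ with $(V\setminus V_k)s=V\setminus V_k$ and $V_k s\subseteq V\setminus V_k$; for connected $\Gamma$ it is independent of $V_k$ up to permutation isomorphism and is called the defect $k$ group of $\Gamma$. -}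

module Defs where

open import Data.Nat using (ℕ; zero; suc; _+_; _∸_; _≤_; NonZero)
open import Data.Nat.DivMod using (_mod_)
open import Data.Fin using (Fin; toℕ; _≟_)
open import Data.Fin.Subset using (Subset; _∈_; ∁; ∣_∣)
open import Data.Bool using (if_then_else_)
open import Data.Product using (Σ; ∃; _×_; _,_)
open import Data.Sum using (_⊎_)
open import Function using (_∘_; id)
open import Relation.Nullary.Decidable using (⌊_⌋)
open import Relation.Binary.PropositionalEquality using (_≡_)

CycleAdj : (n : ℕ) → Fin n → Fin n → Set
CycleAdj n u v =
  (suc (toℕ u) ≡ toℕ v) ⊎ (suc (toℕ v) ≡ toℕ u)
  ⊎ ((toℕ u ≡ 0 × suc (toℕ v) ≡ n) ⊎ (toℕ v ≡ 0 × suc (toℕ u) ≡ n))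

collapse : {n : ℕ} → Fin n → Fin n → Fin n → Fin n
collapse u v x = if ⌊ x ≟ u ⌋ then v else x

-- Transformations act on the right: x (s t) = (x s) t, i.e. s·t = t ∘ s.
-- The flow semigroup S_Γ of C_n (as a predicate on transformations).
data InFlow (n : ℕ) : (Fin n → Fin n) → Set where
  gen  : ∀ {u v} → CycleAdj n u v → InFlow n (collapse u v)
  comp : ∀ {s t} → InFlow n s → InFlow n t → InFlow n (t ∘ s)

InS : (n : ℕ) → (Fin n → Fin n) → Set
InS n s = Σ (Fin n → Fin n) λ f → InFlow n f × (∀ x → f x ≡ s x)

Admissible : {n : ℕ} → Subset n → (Fin n → Fin n) → Set
Admissible {n} Vk s =
  InS n s
  × (∀ x → x ∈ ∁ Vk → s x ∈ ∁ Vk)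
  × (∀ y → y ∈ ∁ Vk → Σ (Fin n) λ x → x ∈ ∁ Vk × s x ≡ y)
  × (∀ x → x ∈ Vk → s x ∈ ∁ Vk)

_≈[_]_ : {n : ℕ} → (Fin n → Fin n) → Subset n → (Fin n → Fin n) → Set
f ≈[ W ] g = ∀ x → x ∈ W → f x ≡ g x

InverseOn : {n : ℕ} → Subset n → (Fin n → Fin n) → (Fin n → Fin n) → Set
InverseOn W f g =
  (∀ x → x ∈ W → g x ∈ W) × ((g ∘ f) ≈[ W ] id) × ((f ∘ g) ≈[ W ] id)

-- An element is represented by a
-- transformation of Fin n, considered only on V∖V_k (equality ≈[ ∁ Vk ]).
data DefectGroup (n : ℕ) (Vk : Subset n) : (Fin n → Fin n) → Set where
  one  : DefectGroup n Vk id
  gen  : ∀ {s} → Admissible Vk s → DefectGroup n Vk s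
  comp : ∀ {f g} → DefectGroup n Vk f → DefectGroup n Vk g → DefectGroup n Vk (g ∘ f)
  inv  : ∀ {f g} → DefectGroup n Vk f → InverseOn (∁ Vk) f g → DefectGroup n Vk g

_+ₘ_ : {m : ℕ} → Fin m → Fin m → Fin m
_+ₘ_ {suc m} i j = (toℕ i + toℕ j) mod suc m

-- A group isomorphism Z_m ≅ DefectGroup n Vk (elements up to ≈[ ∁ Vk ]),
-- with product in the defect group s·t = t ∘ s (right action).
IsoToCyclic : (n : ℕ) → Subset n → (m : ℕ) → Set
IsoToCyclic n Vk m =
  Σ (Fin m → (Fin n → Fin n)) λ φ →
    (∀ i → DefectGroup n Vk (φ i))
    × (∀ i j → φ i ≈[ ∁ Vk ] φ j → i ≡ j)
    × (∀ g → DefectGroup n Vk g → ∃ λ i → φ i ≈[ ∁ Vk ] g)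
    × (∀ i j → φ (i +ₘ j) ≈[ ∁ Vk ] (φ j ∘ φ i))

-- Lift the cycle to ℕ, y ∈ ℕ standing for the vertex y mod n.  Every element of the flow
-- semigroup lifts to a monotone map of ℕ commuting with y ↦ y + n.  Numbering the lifts of
-- the points of W = V ∖ V_k increasingly, an element s permuting W induces a monotone map of
-- ℕ commuting with j ↦ j + m (m = |W| = n - k) that hits every residue mod m, hence a
-- translation j ↦ j + r: on W, s is the r-th power of the rotation ρ sending each point of
-- W to the next one along the cycle.  Conversely ρ is the restriction of an explicit product
-- of collapsings, so the defect group is ⟨ρ⟩ ≅ Z_m.

module Submission where

open import Defs
open import Data.Nat using (ℕ; _≤_; _∸_)
open import Data.Fin.Subset using (Subset; ∣_∣)
open import Relation.Binary.PropositionalEquality using (_≡_)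

open import Data.Nat hiding (_≟_)
open import Data.Nat.Properties hiding (_≟_)
open import Data.Nat.DivMod
open import Data.Fin using (Fin; toℕ; _≟_) renaming (zero to fzero; suc to fsuc)
open import Data.Fin.Properties using (toℕ-injective; toℕ-fromℕ<; fromℕ<-cong; fromℕ<-toℕ; toℕ<n)
open import Data.Fin.Subset using (_∈_; ∁; Nonempty)
open import Data.Fin.Subset.Properties using (x∈∁p⇒x∉p; ∣∁p∣≡n∸∣p∣; nonempty?; Empty-unique; ∣⊥∣≡0)
open import Data.Vec using ([]; _∷_; here; there)
open import Data.Bool using (Bool; true; false; if_then_else_)
open import Data.Product using (Σ; ∃; _×_; _,_; proj₁; proj₂)
open import Data.Sum using (_⊎_; inj₁; inj₂; map₁)
open import Function using (_∘_; id)
open import Relation.Nullary using (¬_; yes; no; contradiction)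
open import Relation.Nullary.Decidable using (⌊_⌋)
open import Relation.Binary.PropositionalEquality
  using (_≢_; refl; sym; trans; cong; cong₂; subst; module ≡-Reasoning)
open import Relation.Binary.Definitions using (tri<; tri≈; tri>)
open import Algebra.Properties.CommutativeSemigroup +-commutativeSemigroup using (xy∙z≈xz∙y)

toℕ-mod : ∀ a n .{{_ : NonZero n}} → toℕ (a mod n) ≡ a % n
toℕ-mod a n = toℕ-fromℕ< (m%n<n a n)

%≡⇒mod≡ : ∀ {a b n} .{{_ : NonZero n}} → a % n ≡ b % n → a mod n ≡ b mod n
%≡⇒mod≡ {a} {b} {n} e = fromℕ<-cong (a % n) (b % n) e (m%n<n a n) (m%n<n b n)

mod≡⇒%≡ : ∀ {a b n} .{{_ : NonZero n}} → a mod n ≡ b mod n → a % n ≡ b % n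
mod≡⇒%≡ {a} {b} {n} e = trans (sym (toℕ-mod a n)) (trans (cong toℕ e) (toℕ-mod b n))

toℕ-mod-cancel : ∀ {n} .{{_ : NonZero n}} (x : Fin n) → toℕ x mod n ≡ x
toℕ-mod-cancel {n} x =
  trans (fromℕ<-cong _ _ (m<n⇒m%n≡m (toℕ<n x)) (m%n<n (toℕ x) n) (toℕ<n x)) (fromℕ<-toℕ x (toℕ<n x))

[m+n]%d≡[m%d+n]%d : ∀ a b d .{{_ : NonZero d}} → (a + b) % d ≡ (a % d + b) % d
[m+n]%d≡[m%d+n]%d a b d = begin
  (a + b) % d             ≡⟨ %-distribˡ-+ a b d ⟩
  (a % d + b % d) % d     ≡⟨ cong (λ r → (r + b % d) % d) (m%n%n≡m%n a d) ⟨
  (a % d % d + b % d) % d ≡⟨ %-distribˡ-+ (a % d) b d ⟨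
  (a % d + b) % d         ∎
  where open ≡-Reasoning

suc-% : ∀ a d .{{_ : NonZero d}} → suc a % d ≡ suc (a % d) % d
suc-% a d = trans (cong (_% d) (+-comm 1 a))
                  (trans ([m+n]%d≡[m%d+n]%d a 1 d) (cong (_% d) (+-comm (a % d) 1)))

-- x and y have equal residues, and the window forces equal quotients.
%-injective-window : ∀ {d} .{{_ : NonZero d}} {x y} →
                     x % d ≡ y % d → y ≤ x → x < y + d → x ≡ y
%-injective-window {d} {x} {y} x≡y y≤x x<y+d with x / d ≤? y / d
... | yes q≤ = ≤-antisym (begin
      x                   ≡⟨ m≡m%n+[m/n]*n x d ⟩
      x % d + (x / d) * d ≤⟨ +-mono-≤ (≤-reflexive x≡y) (*-monoˡ-≤ d q≤) ⟩
      y % d + (y / d) * d ≡⟨ m≡m%n+[m/n]*n y d ⟨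
      y                   ∎) y≤x
  where open ≤-Reasoning
... | no q≰ = contradiction x<y+d (≤⇒≯ (begin
      y + d                         ≡⟨ cong (_+ d) (m≡m%n+[m/n]*n y d) ⟩
      y % d + (y / d) * d + d       ≡⟨ +-assoc (y % d) _ d ⟩
      y % d + ((y / d) * d + d)     ≡⟨ cong (y % d +_) (+-comm _ d) ⟩
      y % d + suc (y / d) * d       ≤⟨ +-mono-≤ (≤-reflexive (sym x≡y)) (*-monoˡ-≤ d (≰⇒> q≰)) ⟩
      x % d + (x / d) * d           ≡⟨ m≡m%n+[m/n]*n x d ⟨
      x                             ∎))
  where open ≤-Reasoning

Shifts : (ℕ → ℕ) → ℕ → ℕ → Set
Shifts F p q = ∀ y → F (y + p) ≡ F y + q

Shifts-* : ∀ {p q} F → Shifts F p q → ∀ c → Shifts F (c * p) (c * q)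
Shifts-* F _ zero y = trans (cong F (+-identityʳ y)) (sym (+-identityʳ (F y)))
Shifts-* {p} {q} F shift (suc c) y = begin
  F (y + (p + c * p)) ≡⟨ cong F (+-assoc y p (c * p)) ⟨
  F (y + p + c * p)   ≡⟨ Shifts-* F shift c (y + p) ⟩
  F (y + p) + c * q   ≡⟨ cong (_+ c * q) (shift y) ⟩
  F y + q + c * q     ≡⟨ +-assoc (F y) q (c * q) ⟩
  F y + (q + c * q)   ∎
  where open ≡-Reasoning

monotone-by-steps : (f : ℕ → ℕ) → (∀ y → f y ≤ f (suc y)) → ∀ {x y} → x ≤ y → f x ≤ f y
monotone-by-steps f step x≤y = go (≤⇒≤′ x≤y)
  where
  go : ∀ {x y} → x ≤′ y → f x ≤ f y
  go ≤′-refl        = ≤-refl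
  go (≤′-step x≤′y) = ≤-trans (go x≤′y) (step _)

sucIf : Bool → ℕ → ℕ
sucIf b k = if b then suc k else k

sucIf-+ : ∀ b a c → sucIf b (a + c) ≡ sucIf b a + c
sucIf-+ true  a c = refl
sucIf-+ false a c = refl

sucIf-comm : ∀ b c a → sucIf b (sucIf c a) ≡ sucIf c (sucIf b a)
sucIf-comm true  true  a = refl
sucIf-comm true  false a = refl
sucIf-comm false true  a = refl
sucIf-comm false false a = refl

n≤sucIf : ∀ b a → a ≤ sucIf b a
n≤sucIf true  a = n≤1+n a
n≤sucIf false a = ≤-refl

countᵇ : (ℕ → Bool) → ℕ → ℕ
countᵇ p zero    = 0
countᵇ p (suc y) = sucIf (p y) (countᵇ p y)

countᵇ-mono : ∀ p {x y} → x ≤ y → countᵇ p x ≤ countᵇ p y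
countᵇ-mono p = monotone-by-steps (countᵇ p) (λ y → n≤sucIf (p y) (countᵇ p y))

countᵇ-cong : ∀ {p q} y → (∀ x → x < y → p x ≡ q x) → countᵇ p y ≡ countᵇ q y
countᵇ-cong zero    p≡q = refl
countᵇ-cong (suc y) p≡q =
  cong₂ sucIf (p≡q y ≤-refl) (countᵇ-cong y (λ x x<y → p≡q x (m≤n⇒m≤1+n x<y)))

countᵇ-suc : ∀ p y → countᵇ p (suc y) ≡ sucIf (p 0) (countᵇ (p ∘ suc) y)
countᵇ-suc p zero    = refl
countᵇ-suc p (suc y) =
  trans (cong (sucIf (p (suc y))) (countᵇ-suc p y)) (sucIf-comm (p (suc y)) (p 0) _)

memberᵇ : ∀ {N} → Subset N → ℕ → Bool
memberᵇ []      _       = false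
memberᵇ (b ∷ p) zero    = b
memberᵇ (b ∷ p) (suc i) = memberᵇ p i

∈⇒memberᵇ : ∀ {N} {p : Subset N} {x} → x ∈ p → memberᵇ p (toℕ x) ≡ true
∈⇒memberᵇ here        = refl
∈⇒memberᵇ (there x∈p) = ∈⇒memberᵇ x∈p

memberᵇ⇒∈ : ∀ {N} (p : Subset N) (x : Fin N) → memberᵇ p (toℕ x) ≡ true → x ∈ p
memberᵇ⇒∈ (true  ∷ p) fzero    _ = here
memberᵇ⇒∈ (b     ∷ p) (fsuc x) e = there (memberᵇ⇒∈ p x e)

∣∷∣ : ∀ {N} b (p : Subset N) → ∣ b ∷ p ∣ ≡ sucIf b ∣ p ∣
∣∷∣ true  p = refl
∣∷∣ false p = refl

countᵇ-memberᵇ : ∀ {N} (p : Subset N) → countᵇ (memberᵇ p) N ≡ ∣ p ∣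
countᵇ-memberᵇ []              = refl
countᵇ-memberᵇ {suc N} (b ∷ p) = begin
  countᵇ (memberᵇ (b ∷ p)) (suc N) ≡⟨ countᵇ-suc (memberᵇ (b ∷ p)) N ⟩
  sucIf b (countᵇ (memberᵇ p) N)   ≡⟨ cong (sucIf b) (countᵇ-memberᵇ p) ⟩
  sucIf b ∣ p ∣                     ≡⟨ ∣∷∣ b p ⟨
  ∣ b ∷ p ∣                         ∎
  where open ≡-Reasoning

module Translation {m : ℕ} .{{_ : NonZero m}} (f : ℕ → ℕ)
  (f-mono : ∀ {i j} → i ≤ j → f i ≤ f j)
  (f-shift : Shifts f m m)
  (f-onto : ∀ t → ∃ λ j → f j % m ≡ t % m) where

  -- Shift a preimage of t by multiples of m into the window.
  hit-in-window : ∀ i t → ∃ λ K → suc i ≤ K × K ≤ i + m × f K % m ≡ t % m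
  hit-in-window i t = K , m≤m+n (suc i) (d % m) , K≤i+m , fK≡t
    where
    j = proj₁ (f-onto t)
    J = j + suc i * m
    d = J ∸ suc i
    K = suc i + d % m

    J≡ : J ≡ K + (d / m) * m
    J≡ = begin
      J                             ≡⟨ m+[n∸m]≡n (≤-trans (m≤m*n (suc i) m) (m≤n+m _ j)) ⟨
      suc i + d                     ≡⟨ cong (suc i +_) (m≡m%n+[m/n]*n d m) ⟩
      suc i + (d % m + (d / m) * m) ≡⟨ +-assoc (suc i) (d % m) _ ⟨
      K + (d / m) * m               ∎
      where open ≡-Reasoning

    K≤i+m : K ≤ i + m
    K≤i+m = ≤-trans (≤-reflexive (sym (+-suc i (d % m)))) (+-monoʳ-≤ i (m%n<n d m))

    fK≡t : f K % m ≡ t % m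
    fK≡t = begin
      f K % m                   ≡⟨ [m+kn]%n≡m%n (f K) (d / m) m ⟨
      (f K + (d / m) * m) % m   ≡⟨ cong (_% m) (Shifts-* f f-shift (d / m) K) ⟨
      f (K + (d / m) * m) % m   ≡⟨ cong (λ y → f y % m) J≡ ⟨
      f J % m                   ≡⟨ cong (_% m) (Shifts-* f f-shift (suc i) j) ⟩
      (f j + suc i * m) % m     ≡⟨ [m+kn]%n≡m%n (f j) (suc i) m ⟩
      f j % m                   ≡⟨ proj₂ (f-onto t) ⟩
      t % m                     ∎
      where open ≡-Reasoning

  -- A jump over f i + 1 would leave that residue unattained in (i, i + m].
  f-suc≤ : ∀ i → f (suc i) ≤ suc (f i)
  f-suc≤ i with f (suc i) ≤? suc (f i) | hit-in-window i (suc (f i))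
  ... | yes f-suc≤ | _ = f-suc≤
  ... | no f-suc≰  | K , i<K , K≤i+m , fK≡ = contradiction fK≡sfi (>⇒≢ fi+1<fK)
    where
    fi+1<fK : suc (f i) < f K
    fi+1<fK = ≤-trans (≰⇒> f-suc≰) (f-mono i<K)

    fK≡sfi : f K ≡ suc (f i)
    fK≡sfi = %-injective-window fK≡ (<⇒≤ fi+1<fK)
               (s≤s (≤-trans (f-mono K≤i+m) (≤-reflexive (f-shift i))))

  f-+≤ : ∀ i k → f (i + k) ≤ f i + k
  f-+≤ i zero    = ≤-reflexive (trans (cong f (+-identityʳ i)) (sym (+-identityʳ (f i))))
  f-+≤ i (suc k) = begin
    f (i + suc k)   ≡⟨ cong f (+-suc i k) ⟩
    f (suc (i + k)) ≤⟨ f-suc≤ (i + k) ⟩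
    suc (f (i + k)) ≤⟨ s≤s (f-+≤ i k) ⟩
    suc (f i + k)   ≡⟨ +-suc (f i) k ⟨
    f i + suc k     ∎
    where open ≤-Reasoning

  -- f i + m ≡ f (i + m) ≤ f (i + 1) + (m - 1).
  f-suc> : ∀ i → f i < f (suc i)
  f-suc> i = +-cancelʳ-≤ (pred m) (suc (f i)) (f (suc i)) (begin
    suc (f i) + pred m   ≡⟨ +-suc (f i) (pred m) ⟨
    f i + suc (pred m)   ≡⟨ cong (f i +_) (suc-pred m) ⟩
    f i + m              ≡⟨ f-shift i ⟨
    f (i + m)            ≡⟨ cong (λ k → f (i + k)) (suc-pred m) ⟨
    f (i + suc (pred m)) ≡⟨ cong f (+-suc i (pred m)) ⟩
    f (suc i + pred m)   ≤⟨ f-+≤ (suc i) (pred m) ⟩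
    f (suc i) + pred m   ∎)
    where open ≤-Reasoning

  translation : ∀ j → f j ≡ f 0 + j
  translation zero    = sym (+-identityʳ (f 0))
  translation (suc j) = begin
    f (suc j)       ≡⟨ ≤-antisym (f-suc≤ j) (f-suc> j) ⟩
    suc (f j)       ≡⟨ cong suc (translation j) ⟩
    suc (f 0 + j)   ≡⟨ +-suc (f 0) j ⟨
    f 0 + suc j     ∎
    where open ≡-Reasoning

module PeriodicMarks {n : ℕ} .{{_ : NonZero n}} (marked : ℕ → Bool)
  (marked-periodic : ∀ y → marked (y + n) ≡ marked y) where

  rank : ℕ → ℕ
  rank = countᵇ marked

  m : ℕ
  m = rank n

  rank-mono : ∀ {x y} → x ≤ y → rank x ≤ rank y
  rank-mono = countᵇ-mono marked

  rank-marked : ∀ {y} → marked y ≡ true → rank (suc y) ≡ suc (rank y)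
  rank-marked {y} e = cong (λ b → sucIf b (rank y)) e

  rank-unmarked : ∀ {y} → marked y ≡ false → rank (suc y) ≡ rank y
  rank-unmarked {y} e = cong (λ b → sucIf b (rank y)) e

  rank-< : ∀ {x y} → x < y → marked x ≡ true → rank x < rank y
  rank-< x<y mx = subst (_≤ _) (rank-marked mx) (rank-mono x<y)

  rank-shift : Shifts rank n m
  rank-shift zero    = refl
  rank-shift (suc y) = begin
    sucIf (marked (y + n)) (rank (y + n)) ≡⟨ cong₂ sucIf (marked-periodic y) (rank-shift y) ⟩
    sucIf (marked y) (rank y + m)         ≡⟨ sucIf-+ (marked y) (rank y) m ⟩
    sucIf (marked y) (rank y) + m         ∎
    where open ≡-Reasoning

  rank-% : ∀ y → rank y ≡ rank (y % n) + (y / n) * m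
  rank-% y = trans (cong rank (m≡m%n+[m/n]*n y n)) (Shifts-* rank rank-shift (y / n) (y % n))

  search : ℕ → ℕ → ℕ
  search zero    a = a
  search (suc k) a = if marked a then a else search k (suc a)

  search-spec : ∀ k a →
    (marked (search k a) ≡ true × a ≤ search k a × rank (search k a) ≡ rank a)
    ⊎ rank (a + k) ≡ rank a
  search-spec zero    a = inj₂ (cong rank (+-identityʳ a))
  search-spec (suc k) a with marked a in ma
  ... | true  = inj₁ (ma , ≤-refl , refl)
  ... | false with search-spec k (suc a)
  ...   | inj₁ (ms , a<s , rs) = inj₁ (ms , <⇒≤ a<s , trans rs (rank-unmarked ma))
  ...   | inj₂ r = inj₂ (trans (cong rank (+-suc a k)) (trans r (rank-unmarked ma)))

  next : ℕ → ℕ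
  next = search n

  module Marks .{{_ : NonZero m}} where

    next-spec : ∀ a → marked (next a) ≡ true × a ≤ next a × rank (next a) ≡ rank a
    next-spec a with search-spec n a
    ... | inj₁ found = found
    ... | inj₂ r = contradiction (trans (sym (rank-shift a)) r) (m+n≢m (rank a) m)
      where
      m+n≢m : ∀ a b .{{_ : NonZero b}} → a + b ≢ a
      m+n≢m a b = >⇒≢ (m<m+n a (>-nonZero⁻¹ b))

    marked-next : ∀ a → marked (next a) ≡ true
    marked-next a = proj₁ (next-spec a)

    ≤-next : ∀ a → a ≤ next a
    ≤-next a = proj₁ (proj₂ (next-spec a))

    rank-next : ∀ a → rank (next a) ≡ rank a
    rank-next a = proj₂ (proj₂ (next-spec a))

    next-least : ∀ {a z} → a ≤ z → marked z ≡ true → next a ≤ z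
    next-least {a} {z} a≤z mz with next a ≤? z
    ... | yes ≤z = ≤z
    ... | no  ≰z = contradiction (rank-< (≰⇒> ≰z) mz)
                     (≤⇒≯ (≤-trans (≤-reflexive (rank-next a)) (rank-mono a≤z)))

    next-unique : ∀ {a z} → a ≤ z → marked z ≡ true → rank z ≡ rank a → next a ≡ z
    next-unique {a} {z} a≤z mz rz with next a <? z
    ... | no  ≮z = ≤-antisym (next-least a≤z mz) (≮⇒≥ ≮z)
    ... | yes <z = contradiction (rank-< <z (marked-next a))
                     (≤⇒≯ (≤-reflexive (trans rz (sym (rank-next a)))))

    next-marked : ∀ {a} → marked a ≡ true → next a ≡ a
    next-marked ma = next-unique ≤-refl ma refl

    next-unmarked : ∀ {a} → marked a ≡ false → next (suc a) ≡ next a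
    next-unmarked {a} ma = sym (next-unique (≤-trans (n≤1+n a) (≤-next (suc a)))
      (marked-next (suc a)) (trans (rank-next (suc a)) (rank-unmarked ma)))

    next-shift : Shifts next n n
    next-shift a = next-unique (+-monoˡ-≤ n (≤-next a))
      (trans (marked-periodic (next a)) (marked-next a))
      (trans (rank-shift (next a)) (trans (cong (_+ m) (rank-next a)) (sym (rank-shift a))))

    enum : ℕ → ℕ
    enum zero    = next 0
    enum (suc j) = next (suc (enum j))

    marked-enum : ∀ j → marked (enum j) ≡ true
    marked-enum zero    = marked-next 0
    marked-enum (suc j) = marked-next (suc (enum j))

    rank-enum : ∀ j → rank (enum j) ≡ j
    rank-enum zero    = rank-next 0
    rank-enum (suc j) = trans (rank-next (suc (enum j)))
      (trans (rank-marked (marked-enum j)) (cong suc (rank-enum j)))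

    enum-rank : ∀ {y} → marked y ≡ true → enum (rank y) ≡ y
    enum-rank {y} my with <-cmp (enum (rank y)) y
    ... | tri≈ _ e _ = e
    ... | tri< e<y _ _ = contradiction (rank-< e<y (marked-enum (rank y)))
                           (≤⇒≯ (≤-reflexive (sym (rank-enum (rank y)))))
    ... | tri> _ _ y<e = contradiction (rank-< y<e my)
                           (≤⇒≯ (≤-reflexive (rank-enum (rank y))))

    enum-mono : ∀ {i j} → i ≤ j → enum i ≤ enum j
    enum-mono = monotone-by-steps enum (λ j → <⇒≤ (≤-next (suc (enum j))))

    enum-shift : Shifts enum m n
    enum-shift j = begin
      enum (j + m)              ≡⟨ cong (λ i → enum (i + m)) (rank-enum j) ⟨
      enum (rank (enum j) + m)  ≡⟨ cong enum (rank-shift (enum j)) ⟨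
      enum (rank (enum j + n))  ≡⟨ enum-rank (trans (marked-periodic (enum j)) (marked-enum j)) ⟩
      enum j + n                ∎
      where open ≡-Reasoning

module Rotation {n : ℕ} .{{_ : NonZero n}} (W : Subset n) where

  marked : ℕ → Bool
  marked y = memberᵇ W (y % n)

  open PeriodicMarks marked (λ y → cong (memberᵇ W) ([m+n]%n≡m%n y n)) public

  marked-toℕ : ∀ x → marked (toℕ x) ≡ memberᵇ W (toℕ x)
  marked-toℕ x = cong (memberᵇ W) (m<n⇒m%n≡m (toℕ<n x))

  ∈⇒marked : ∀ {x} → x ∈ W → marked (toℕ x) ≡ true
  ∈⇒marked {x} x∈W = trans (marked-toℕ x) (∈⇒memberᵇ x∈W)

  marked⇒∈ : ∀ {x} → marked (toℕ x) ≡ true → x ∈ W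
  marked⇒∈ {x} e = memberᵇ⇒∈ W x (trans (sym (marked-toℕ x)) e)

  marked-mod : ∀ y → marked (toℕ (y mod n)) ≡ marked y
  marked-mod y = trans (cong marked (toℕ-mod y n)) (cong (memberᵇ W) (m%n%n≡m%n y n))

  ∉⇒unmarked : ∀ {x} → ¬ x ∈ W → marked (toℕ x) ≡ false
  ∉⇒unmarked {x} x∉W with marked (toℕ x) in e
  ... | false = refl
  ... | true  = contradiction (marked⇒∈ e) x∉W

  mod∈⇒marked : ∀ y → y mod n ∈ W → marked y ≡ true
  mod∈⇒marked y e = trans (sym (marked-mod y)) (∈⇒marked e)

  marked⇒mod∈ : ∀ y → marked y ≡ true → y mod n ∈ W
  marked⇒mod∈ y e = marked⇒∈ (trans (marked-mod y) e)

  m≡∣W∣ : m ≡ ∣ W ∣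
  m≡∣W∣ = trans (countᵇ-cong n (λ x x<n → cong (memberᵇ W) (m<n⇒m%n≡m x<n)))
                (countᵇ-memberᵇ W)

  module Rotations .{{_ : NonZero m}} where
    open Marks public

    rank-cong-% : ∀ y z → y % n ≡ z % n → rank y % m ≡ rank z % m
    rank-cong-% y z y≡z = begin
      rank y % m                              ≡⟨ cong (_% m) (rank-% y) ⟩
      (rank (y % n) + (y / n) * m) % m        ≡⟨ [m+kn]%n≡m%n (rank (y % n)) (y / n) m ⟩
      rank (y % n) % m                        ≡⟨ cong (λ r → rank r % m) y≡z ⟩
      rank (z % n) % m                        ≡⟨ [m+kn]%n≡m%n (rank (z % n)) (z / n) m ⟨
      (rank (z % n) + (z / n) * m) % m        ≡⟨ cong (_% m) (rank-% z) ⟨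
      rank z % m                              ∎
      where open ≡-Reasoning

    -- x ∈ W is the (rank x)-th marked point; rotate r moves it r marked points on.
    rotate : ℕ → Fin n → Fin n
    rotate r x = enum (rank (toℕ x) + r) mod n

    rotate-∈ : ∀ r x → rotate r x ∈ W
    rotate-∈ r x = marked⇒mod∈ _ (marked-enum (rank (toℕ x) + r))

    rotate-mod : ∀ r y → rotate r (y mod n) ≡ enum (rank y + r) mod n
    rotate-mod r y = %≡⇒mod≡ (begin
      enum (rank (toℕ (y mod n)) + r) % n             ≡⟨ cong (λ z → enum (rank z + r) % n) (toℕ-mod y n) ⟩
      enum (rank (y % n) + r) % n                     ≡⟨ [m+kn]%n≡m%n (enum (rank (y % n) + r)) (y / n) n ⟨
      (enum (rank (y % n) + r) + (y / n) * n) % n     ≡⟨ cong (_% n) (Shifts-* enum enum-shift (y / n) (rank (y % n) + r)) ⟨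
      enum (rank (y % n) + r + (y / n) * m) % n       ≡⟨ cong (λ z → enum z % n) (xy∙z≈xz∙y (rank (y % n)) r _) ⟩
      enum (rank (y % n) + (y / n) * m + r) % n       ≡⟨ cong (λ z → enum (z + r) % n) (rank-% y) ⟨
      enum (rank y + r) % n                           ∎)
      where open ≡-Reasoning

    rotate-+ : ∀ r s x → rotate s (rotate r x) ≡ rotate (r + s) x
    rotate-+ r s x = trans (rotate-mod s (enum (rank (toℕ x) + r)))
      (cong (λ z → enum z mod n) (trans (cong (_+ s) (rank-enum _)) (+-assoc (rank (toℕ x)) r s)))

    rotate-0 : ∀ {x} → x ∈ W → rotate 0 x ≡ x
    rotate-0 {x} x∈W = begin
      enum (rank (toℕ x) + 0) mod n ≡⟨ cong (λ z → enum z mod n) (+-identityʳ (rank (toℕ x))) ⟩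
      enum (rank (toℕ x)) mod n     ≡⟨ cong (_mod n) (enum-rank (∈⇒marked x∈W)) ⟩
      toℕ x mod n                   ≡⟨ toℕ-mod-cancel x ⟩
      x                             ∎
      where open ≡-Reasoning

    rotate-+* : ∀ r c x → rotate (r + c * m) x ≡ rotate r x
    rotate-+* r c x = %≡⇒mod≡ (begin
      enum (rank (toℕ x) + (r + c * m)) % n ≡⟨ cong (λ z → enum z % n) (+-assoc (rank (toℕ x)) r _) ⟨
      enum (rank (toℕ x) + r + c * m) % n   ≡⟨ cong (_% n) (Shifts-* enum enum-shift c (rank (toℕ x) + r)) ⟩
      (enum (rank (toℕ x) + r) + c * n) % n ≡⟨ [m+kn]%n≡m%n (enum (rank (toℕ x) + r)) c n ⟩
      enum (rank (toℕ x) + r) % n           ∎)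
      where open ≡-Reasoning

    rotate-% : ∀ r x → rotate (r % m) x ≡ rotate r x
    rotate-% r x = trans (sym (rotate-+* (r % m) (r / m) x))
                         (cong (λ s → rotate s x) (sym (m≡m%n+[m/n]*n r m)))

    rotate-*m : ∀ c {x} → x ∈ W → rotate (c * m) x ≡ x
    rotate-*m c {x} x∈W = trans (rotate-+* 0 c x) (rotate-0 x∈W)

    -- r + r * (m - 1) ≡ r * m is a whole number of turns.
    rotate-inverse : ∀ r → InverseOn W (rotate r) (rotate (r * pred m))
    rotate-inverse r = (λ x _ → rotate-∈ _ x) , cancelˡ , cancelʳ
      where
      r+r*pred≡r*m : r + r * pred m ≡ r * m
      r+r*pred≡r*m = trans (sym (*-suc r (pred m))) (cong (r *_) (suc-pred m))

      cancelˡ : (rotate (r * pred m) ∘ rotate r) ≈[ W ] id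
      cancelˡ x x∈W = trans (rotate-+ r _ x)
        (trans (cong (λ s → rotate s x) r+r*pred≡r*m) (rotate-*m r x∈W))

      cancelʳ : (rotate r ∘ rotate (r * pred m)) ≈[ W ] id
      cancelʳ x x∈W = trans (rotate-+ _ r x)
        (trans (cong (λ s → rotate s x) (trans (+-comm _ r) r+r*pred≡r*m)) (rotate-*m r x∈W))

    rotate-injective : ∀ {i j} → i < m → j < m → rotate i ≈[ W ] rotate j → i ≡ j
    rotate-injective {i} {j} i<m j<m i≈j = begin
      i                 ≡⟨ m<n⇒m%n≡m i<m ⟨
      i % m             ≡⟨ cong (_% m) (rank-enum i) ⟨
      rank (enum i) % m ≡⟨ rank-cong-% (enum i) (enum j) enum-i≡enum-j ⟩
      rank (enum j) % m ≡⟨ cong (_% m) (rank-enum j) ⟩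
      j % m             ≡⟨ m<n⇒m%n≡m j<m ⟩
      j                 ∎
      where
      open ≡-Reasoning
      x₀ = enum 0 mod n

      at-x₀ : ∀ r → rotate r x₀ ≡ enum r mod n
      at-x₀ r = trans (rotate-mod r (enum 0)) (cong (λ k → enum (k + r) mod n) (rank-enum 0))

      enum-i≡enum-j : enum i % n ≡ enum j % n
      enum-i≡enum-j = mod≡⇒%≡ {enum i} {enum j}
        (trans (sym (at-x₀ i)) (trans (i≈j x₀ (marked⇒mod∈ (enum 0) (marked-enum 0))) (at-x₀ j)))

module Lifts (n' : ℕ) where

  n : ℕ
  n = suc n'

  mod-+n : ∀ y → (y + n) mod n ≡ y mod n
  mod-+n y = %≡⇒mod≡ {y + n} {y} ([m+n]%n≡m%n y n)

  Reduces : (ℕ → ℕ) → (Fin n → Fin n) → Set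
  Reduces F s = ∀ y → F y mod n ≡ s (y mod n)

  IsLift : (Fin n → Fin n) → (ℕ → ℕ) → Set
  IsLift s F = (∀ {x y} → x ≤ y → F x ≤ F y) × Shifts F n n × Reduces F s

  Reduces-∘ : ∀ {F G s t} → Reduces F s → Reduces G t → Reduces (G ∘ F) (t ∘ s)
  Reduces-∘ {F} {t = t} F↓s G↓t y = trans (G↓t (F y)) (cong t (F↓s y))

  IsLift-∘ : ∀ {F G s t} → IsLift s F → IsLift t G → IsLift (t ∘ s) (G ∘ F)
  IsLift-∘ {F} {G} {s} {t} (F-mono , F-shift , F↓s) (G-mono , G-shift , G↓t) =
    G-mono ∘ F-mono ,
    (λ y → trans (cong G (F-shift y)) (G-shift (F y))) ,
    Reduces-∘ {F} {G} {s} {t} F↓s G↓t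

  within-one-mono : ∀ (F : ℕ → ℕ) a → (∀ y → y + a ≤ F y) → (∀ y → F y ≤ suc (y + a)) →
                    ∀ {x y} → x ≤ y → F x ≤ F y
  within-one-mono F a lower upper = monotone-by-steps F (λ y → ≤-trans (upper y) (lower (suc y)))

  step⁺ : Fin n → ℕ → ℕ
  step⁺ u y = if ⌊ y mod n ≟ u ⌋ then suc y else y

  -- The lift of e_uv for v = u - 1 is placed one period up, avoiding truncated subtraction.
  step⁻ : Fin n → ℕ → ℕ
  step⁻ u y = if ⌊ y mod n ≟ u ⌋ then y + n' else y + n

  step⁺-hit : ∀ {u y} → y mod n ≡ u → step⁺ u y ≡ suc y
  step⁺-hit {u} {y} e with y mod n ≟ u
  ... | yes _  = refl
  ... | no  ≢u = contradiction e ≢u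

  step⁺-miss : ∀ {u y} → y mod n ≢ u → step⁺ u y ≡ y
  step⁺-miss {u} {y} ≢u with y mod n ≟ u
  ... | yes e = contradiction e ≢u
  ... | no  _ = refl

  step⁺-lift : ∀ {u v} → suc (toℕ u) % n ≡ toℕ v → IsLift (collapse u v) (step⁺ u)
  step⁺-lift {u} {v} u+1≡v = within-one-mono (step⁺ u) 0 lower upper , shift , reduces
    where
    lower : ∀ y → y + 0 ≤ step⁺ u y
    lower y with y mod n ≟ u
    ... | yes _ = ≤-trans (≤-reflexive (+-identityʳ y)) (n≤1+n y)
    ... | no  _ = ≤-reflexive (+-identityʳ y)

    upper : ∀ y → step⁺ u y ≤ suc (y + 0)
    upper y with y mod n ≟ u
    ... | yes _ = ≤-reflexive (cong suc (sym (+-identityʳ y)))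
    ... | no  _ = ≤-trans (n≤1+n y) (≤-reflexive (cong suc (sym (+-identityʳ y))))

    shift : Shifts (step⁺ u) n n
    shift y rewrite mod-+n y with y mod n ≟ u
    ... | yes _ = refl
    ... | no  _ = refl

    reduces : Reduces (step⁺ u) (collapse u v)
    reduces y with y mod n ≟ u
    ... | no  _  = refl
    ... | yes y≡u = toℕ-injective (begin
      toℕ (suc y mod n) ≡⟨ toℕ-mod (suc y) n ⟩
      suc y % n         ≡⟨ suc-% y n ⟩
      suc (y % n) % n   ≡⟨ cong (λ z → suc z % n) (trans (sym (toℕ-mod y n)) (cong toℕ y≡u)) ⟩
      suc (toℕ u) % n   ≡⟨ u+1≡v ⟩
      toℕ v             ∎)
      where open ≡-Reasoning

  step⁻-lift : ∀ {u v} → (toℕ u + n') % n ≡ toℕ v → IsLift (collapse u v) (step⁻ u)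
  step⁻-lift {u} {v} u+n'≡v = within-one-mono (step⁻ u) n' lower upper , shift , reduces
    where
    lower : ∀ y → y + n' ≤ step⁻ u y
    lower y with y mod n ≟ u
    ... | yes _ = ≤-refl
    ... | no  _ = +-monoʳ-≤ y (n≤1+n n')

    upper : ∀ y → step⁻ u y ≤ suc (y + n')
    upper y with y mod n ≟ u
    ... | yes _ = n≤1+n (y + n')
    ... | no  _ = ≤-reflexive (+-suc y n')

    shift : Shifts (step⁻ u) n n
    shift y rewrite mod-+n y with y mod n ≟ u
    ... | yes _ = trans (+-assoc y n n') (trans (cong (y +_) (+-comm n n')) (sym (+-assoc y n' n)))
    ... | no  _ = refl

    reduces : Reduces (step⁻ u) (collapse u v)
    reduces y with y mod n ≟ u
    ... | no  _  = mod-+n y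
    ... | yes y≡u = toℕ-injective (begin
      toℕ ((y + n') mod n) ≡⟨ toℕ-mod (y + n') n ⟩
      (y + n') % n         ≡⟨ [m+n]%d≡[m%d+n]%d y n' n ⟩
      (y % n + n') % n     ≡⟨ cong (λ z → (z + n') % n) (trans (sym (toℕ-mod y n)) (cong toℕ y≡u)) ⟩
      (toℕ u + n') % n     ≡⟨ u+n'≡v ⟩
      toℕ v                ∎)
      where open ≡-Reasoning

  adjacent-step : ∀ {u v} → CycleAdj n u v →
                  suc (toℕ u) % n ≡ toℕ v ⊎ (toℕ u + n') % n ≡ toℕ v
  adjacent-step {u} {v} (inj₁ u+1≡v) =
    inj₁ (trans (cong (_% n) u+1≡v) (m<n⇒m%n≡m (toℕ<n v)))
  adjacent-step {u} {v} (inj₂ (inj₁ v+1≡u)) = inj₂ (begin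
    (toℕ u + n') % n       ≡⟨ cong (λ z → (z + n') % n) v+1≡u ⟨
    (suc (toℕ v) + n') % n ≡⟨ cong (_% n) (+-suc (toℕ v) n') ⟨
    (toℕ v + n) % n        ≡⟨ [m+n]%n≡m%n (toℕ v) n ⟩
    toℕ v % n              ≡⟨ m<n⇒m%n≡m (toℕ<n v) ⟩
    toℕ v                  ∎)
    where open ≡-Reasoning
  adjacent-step {u} {v} (inj₂ (inj₂ (inj₁ (u≡0 , v+1≡n)))) =
    inj₂ (trans (cong (λ z → (z + n') % n) u≡0)
                (trans (m<n⇒m%n≡m (n<1+n n')) (sym (suc-injective v+1≡n))))
  adjacent-step {u} {v} (inj₂ (inj₂ (inj₂ (v≡0 , u+1≡n)))) =
    inj₁ (trans (cong (_% n) u+1≡n) (trans (n%n≡0 n) (sym v≡0)))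

  flow-lift : ∀ {s} → InFlow n s → Σ (ℕ → ℕ) (IsLift s)
  flow-lift (gen {u} adj) with adjacent-step adj
  ... | inj₁ u+1≡v  = step⁺ u , step⁺-lift u+1≡v
  ... | inj₂ u+n'≡v = step⁻ u , step⁻-lift u+n'≡v
  flow-lift (comp {s} {t} s∈ t∈) with flow-lift s∈ | flow-lift t∈
  ... | F , F↑ | G , G↑ = G ∘ F , IsLift-∘ {F} {G} {s} {t} F↑ G↑

  InS-lift : ∀ {s} → InS n s → Σ (ℕ → ℕ) (IsLift s)
  InS-lift (f , f∈ , f≗s) with flow-lift f∈
  ... | F , (F-mono , F-shift , F↓f) = F , (F-mono , F-shift , λ y → trans (F↓f y) (f≗s (y mod n)))

  FlowLift : (ℕ → ℕ) → Set
  FlowLift H = Σ (Fin n → Fin n) λ g → InFlow n g × Reduces H g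

  FlowLift-∘ : ∀ {F G} → FlowLift F → FlowLift G → FlowLift (G ∘ F)
  FlowLift-∘ {F} {G} (s , s∈ , F↓s) (t , t∈ , G↓t) = t ∘ s , comp s∈ t∈ , Reduces-∘ {F} {G} {s} {t} F↓s G↓t

  push : ℕ → ℕ → ℕ
  push a = step⁺ (a mod n)

  push-flow : ∀ a → FlowLift (push a)
  push-flow a = collapse (a mod n) (suc a mod n) , gen adjacent , proj₂ (proj₂ (step⁺-lift a+1≡))
    where
    a+1≡ : suc (toℕ (a mod n)) % n ≡ toℕ (suc a mod n)
    a+1≡ = trans (cong (λ z → suc z % n) (toℕ-mod a n)) (trans (sym (suc-% a n)) (sym (toℕ-mod (suc a) n)))

    adjacent : CycleAdj n (a mod n) (suc a mod n)
    adjacent with suc (toℕ (a mod n)) <? n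
    ... | yes a+1<n = inj₁ (trans (sym (m<n⇒m%n≡m a+1<n)) a+1≡)
    ... | no  a+1≮n = inj₂ (inj₂ (inj₂ (trans (sym a+1≡) (trans (cong (_% n) a+1≡n) (n%n≡0 n)) , a+1≡n)))
      where
      a+1≡n : suc (toℕ (a mod n)) ≡ n
      a+1≡n = ≤-antisym (toℕ<n (a mod n)) (≮⇒≥ a+1≮n)

InverseOn-congˡ : ∀ {n} {W : Subset n} {f f′ g} → f ≈[ W ] f′ → InverseOn W f′ g → InverseOn W f g
InverseOn-congˡ {g = g} f≈f′ (g∈ , g∘f′≈id , f′∘g≈id) =
  g∈ , (λ x x∈W → trans (cong g (f≈f′ x x∈W)) (g∘f′≈id x x∈W)) ,
       (λ x x∈W → trans (f≈f′ (g x) (g∈ x x∈W)) (f′∘g≈id x x∈W))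

InverseOn-sym : ∀ {n} {W : Subset n} {f g} → (∀ x → x ∈ W → f x ∈ W) → InverseOn W f g → InverseOn W g f
InverseOn-sym f∈ (_ , g∘f≈id , f∘g≈id) = f∈ , f∘g≈id , g∘f≈id

module Cycle (n-2 : ℕ) (Vk : Subset (suc (suc n-2))) where

  open Lifts (suc n-2) public

  W : Subset n
  W = ∁ Vk

  open Rotation W public

  module Defect .{{_ : NonZero m}} where
    open Rotations public

    -- f j is the rank of the image of the j-th marked point; by the translation lemma
    -- f j ≡ f 0 + j, so s moves every point of W by f 0 marked points.
    module AdmissibleLift {s F} (F-mono : ∀ {x y} → x ≤ y → F x ≤ F y) (F-shift : Shifts F n n)
      (F↓s : Reduces F s) (s-into : ∀ x → x ∈ W → s x ∈ W)
      (s-onto : ∀ y → y ∈ W → ∃ λ x → x ∈ W × s x ≡ y) where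

      f : ℕ → ℕ
      f j = rank (F (enum j))

      marked-F-enum : ∀ j → marked (F (enum j)) ≡ true
      marked-F-enum j = mod∈⇒marked (F (enum j))
        (subst (_∈ W) (sym (F↓s (enum j))) (s-into _ (marked⇒mod∈ (enum j) (marked-enum j))))

      f-shift : Shifts f m m
      f-shift j = begin
        rank (F (enum (j + m))) ≡⟨ cong (λ y → rank (F y)) (enum-shift j) ⟩
        rank (F (enum j + n))   ≡⟨ cong rank (F-shift (enum j)) ⟩
        rank (F (enum j) + n)   ≡⟨ rank-shift (F (enum j)) ⟩
        f j + m                 ∎
        where open ≡-Reasoning

      f-onto : ∀ t → ∃ λ j → f j % m ≡ t % m
      f-onto t with s-onto (enum t mod n) (marked⇒mod∈ (enum t) (marked-enum t))
      ... | x , x∈W , sx≡ = rank (toℕ x) , (begin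
        rank (F (enum (rank (toℕ x)))) % m ≡⟨ cong (λ y → rank (F y) % m) (enum-rank (∈⇒marked x∈W)) ⟩
        rank (F (toℕ x)) % m               ≡⟨ rank-cong-% (F (toℕ x)) (enum t) F[x]≡ ⟩
        rank (enum t) % m                  ≡⟨ cong (_% m) (rank-enum t) ⟩
        t % m                              ∎)
        where
        open ≡-Reasoning
        F[x]≡ : F (toℕ x) % n ≡ enum t % n
        F[x]≡ = mod≡⇒%≡ {F (toℕ x)} {enum t} (trans (F↓s (toℕ x)) (trans (cong s (toℕ-mod-cancel x)) sx≡))

      f-translation : ∀ j → f j ≡ f 0 + j
      f-translation = Translation.translation f (rank-mono ∘ F-mono ∘ enum-mono) f-shift f-onto

      s≈rotate : s ≈[ W ] rotate (f 0)
      s≈rotate x x∈W = begin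
        s x                      ≡⟨ cong s (toℕ-mod-cancel x) ⟨
        s (toℕ x mod n)          ≡⟨ F↓s (toℕ x) ⟨
        F (toℕ x) mod n          ≡⟨ cong (λ y → F y mod n) (enum-rank (∈⇒marked x∈W)) ⟨
        F (enum j) mod n         ≡⟨ cong (_mod n) (enum-rank {F (enum j)} (marked-F-enum j)) ⟨
        enum (f j) mod n         ≡⟨ cong (λ i → enum i mod n) (trans (f-translation j) (+-comm (f 0) j)) ⟩
        enum (j + f 0) mod n     ∎
        where
        open ≡-Reasoning
        j = rank (toℕ x)

    admissible⇒rotation : ∀ {s} → Admissible Vk s → ∃ λ r → s ≈[ W ] rotate r
    admissible⇒rotation (s∈S , s-into , s-onto , _) with InS-lift s∈S
    ... | F , F-mono , F-shift , F↓s = f 0 , s≈rotate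
      where open AdmissibleLift F-mono F-shift F↓s s-into s-onto

    unmarked-before-marked : ∀ {a} → marked a ≡ false →
      ∃ λ b → b < n × marked b ≡ false × marked (suc b) ≡ true
    unmarked-before-marked {a} ma = w % n , m%n<n w n , mb , mb+1
      where
      z = next a

      a<z : a < z
      a<z = ≤∧≢⇒< (≤-next a) a≢z
        where
        a≢z : a ≢ z
        a≢z a≡z with trans (sym ma) (trans (cong marked a≡z) (marked-next a))
        ... | ()

      w = pred z

      w+1≡z : suc w ≡ z
      w+1≡z = suc-pred z ⦃ >-nonZero (≤-<-trans z≤n a<z) ⦄

      mw : marked w ≡ false
      mw with marked w in e
      ... | false = refl
      ... | true  = contradiction (next-least (s≤s⁻¹ (subst (a <_) (sym w+1≡z) a<z)) e)
                                  (<⇒≱ (subst (w <_) w+1≡z ≤-refl))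

      mb : marked (w % n) ≡ false
      mb = trans (cong (memberᵇ W) (m%n%n≡m%n w n)) mw

      mb+1 : marked (suc (w % n)) ≡ true
      mb+1 = trans (cong (memberᵇ W) (sym (suc-% w n)))
                   (trans (cong marked w+1≡z) (marked-next a))

    -- Each y ∈ (b, b + n] moves to next (suc y): a marked point to the following one, the
    -- unmarked points along with them.  The sweep pushes positions b + 1, …, b + n - 1 and
    -- pushes L + 1 before L exactly when L + 1 is marked; the final push carries the class
    -- of b, whose successor class is marked, one step further.
    module Advance (b : ℕ) (b<n : b < n) (mb : marked b ≡ false) (mb+1 : marked (suc b) ≡ true) where

      T : ℕ
      T = b + n

      mT : marked T ≡ false
      mT = trans (cong (memberᵇ W) ([m+n]%n≡m%n b n)) mb

      mT+1 : marked (suc T) ≡ true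
      mT+1 = trans (cong (memberᵇ W) ([m+n]%n≡m%n (suc b) n)) mb+1

      window-injective : ∀ {x y} → b < x → x ≤ T → b < y → y ≤ T → x % n ≡ y % n → x ≡ y
      window-injective {x} {y} b<x x≤T b<y y≤T x≡y with ≤-total y x
      ... | inj₁ y≤x = %-injective-window x≡y y≤x (≤-<-trans x≤T (+-monoˡ-< n b<y))
      ... | inj₂ x≤y = sym (%-injective-window (sym x≡y) x≤y (≤-<-trans y≤T (+-monoˡ-< n b<x)))

      push-hit : ∀ a → push a a ≡ suc a
      push-hit a = step⁺-hit refl

      push-miss : ∀ {a y} → b < a → a ≤ T → b < y → y ≤ T → y ≢ a → push a y ≡ y
      push-miss {a} {y} b<a a≤T b<y y≤T y≢a =
        step⁺-miss (λ y≡a → y≢a (window-injective b<y y≤T b<a a≤T (mod≡⇒%≡ {y} {a} y≡a)))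

      sweep : ℕ → ℕ → ℕ → ℕ
      sweep zero    L = push L
      sweep (suc c) L = if marked (suc L) then push L ∘ sweep c (suc L) else sweep c (suc L) ∘ push L

      sweep-flow : ∀ c L → FlowLift (sweep c L)
      sweep-flow zero    L = push-flow L
      sweep-flow (suc c) L with marked (suc L)
      ... | true  = FlowLift-∘ {sweep c (suc L)} {push L} (sweep-flow c (suc L)) (push-flow L)
      ... | false = FlowLift-∘ {push L} {sweep c (suc L)} (push-flow L) (sweep-flow c (suc L))

      reach : ℕ → ℕ
      reach y = next (suc y) ⊓ T

      <-reach : ∀ {y} → y < T → y < reach y
      <-reach {y} y<T = ⊓-glb (≤-next (suc y)) y<T

      reach-≤ : ∀ y → reach y ≤ T
      reach-≤ y = m⊓n≤n (next (suc y)) T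

      +-suc≡T⇒< : ∀ L c → L + suc c ≡ T → L < T
      +-suc≡T⇒< L c e = subst (L <_) e (m<m+n L z<s)

      +-suc-≡ : ∀ {L c} → L + suc (suc c) ≡ T → suc L + suc c ≡ T
      +-suc-≡ {L} {c} e = trans (sym (+-suc L (suc c))) e

      push-outside : ∀ {L c} → L + suc c ≡ T → b < L →
                     ∀ {y} → b < y → y < L ⊎ y ≡ T → push L y ≡ y
      push-outside {L} {c} e b<L b<y (inj₁ y<L) =
        push-miss b<L (<⇒≤ L<T) b<y (<⇒≤ (<-trans y<L L<T)) (λ y≡L → <-irrefl y≡L y<L)
        where L<T = +-suc≡T⇒< L c e
      push-outside {L} {c} e b<L b<y (inj₂ refl) =
        push-miss b<L (<⇒≤ L<T) b<y ≤-refl (λ T≡L → <-irrefl (sym T≡L) L<T)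
        where L<T = +-suc≡T⇒< L c e

      sweep-outside : ∀ c L → L + suc c ≡ T → b < L →
                      ∀ {y} → b < y → y < L ⊎ y ≡ T → sweep c L y ≡ y
      sweep-outside zero    L e b<L b<y y-out = push-outside e b<L b<y y-out
      sweep-outside (suc c) L e b<L {y} b<y y-out = by-mark (marked (suc L))
        where
        ih : sweep c (suc L) y ≡ y
        ih = sweep-outside c (suc L) (+-suc-≡ e) (m≤n⇒m≤1+n b<L) b<y
               (map₁ m≤n⇒m≤1+n y-out)

        by-mark : ∀ β → (if β then push L ∘ sweep c (suc L) else sweep c (suc L) ∘ push L) y ≡ y
        by-mark true  = trans (cong (push L) ih) (push-outside e b<L b<y y-out)
        by-mark false = trans (cong (sweep c (suc L)) (push-outside e b<L b<y y-out)) ih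

      sweep-inside : ∀ c L → L + suc c ≡ T → b < L →
                     ∀ {y} → L ≤ y → y < T → sweep c L y ≡ reach y
      sweep-inside-suc : ∀ c L → L + suc (suc c) ≡ T → b < L →
                         ∀ {y} → L < y ⊎ L ≡ y → y < T → sweep (suc c) L y ≡ reach y

      sweep-inside zero L e b<L {y} L≤y y<T = begin
        push L y   ≡⟨ cong (push L) y≡L ⟩
        push L L   ≡⟨ push-hit L ⟩
        suc L      ≡⟨ L+1≡T ⟩
        T          ≡⟨ m≥n⇒m⊓n≡n (subst (λ z → T ≤ next z) (sym (trans (cong suc y≡L) L+1≡T)) (≤-next T)) ⟨
        reach y    ∎
        where
        open ≡-Reasoning
        L+1≡T : suc L ≡ T
        L+1≡T = trans (+-comm 1 L) e
        y≡L : y ≡ L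
        y≡L = ≤-antisym (s≤s⁻¹ (subst (y <_) (sym L+1≡T) y<T)) L≤y
      sweep-inside (suc c) L e b<L L≤y y<T = sweep-inside-suc c L e b<L (m≤n⇒m<n∨m≡n L≤y) y<T

      sweep-inside-suc c L e b<L (inj₂ refl) y<T = at-L (marked (suc L)) refl
        where
        e′ = +-suc-≡ e
        b<L+1 = m≤n⇒m≤1+n b<L

        at-L : ∀ β → marked (suc L) ≡ β →
               (if β then push L ∘ sweep c (suc L) else sweep c (suc L) ∘ push L) L ≡ reach L
        at-L true m = begin
          push L (sweep c (suc L) L) ≡⟨ cong (push L) (sweep-outside c (suc L) e′ b<L+1 b<L (inj₁ ≤-refl)) ⟩
          push L L                   ≡⟨ push-hit L ⟩
          suc L                      ≡⟨ m≤n⇒m⊓n≡m (<⇒≤ (+-suc≡T⇒< (suc L) c e′)) ⟨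
          suc L ⊓ T                  ≡⟨ cong (_⊓ T) (next-marked m) ⟨
          reach L                    ∎
          where open ≡-Reasoning
        at-L false m = begin
          sweep c (suc L) (push L L) ≡⟨ cong (sweep c (suc L)) (push-hit L) ⟩
          sweep c (suc L) (suc L)    ≡⟨ sweep-inside c (suc L) e′ b<L+1 ≤-refl (+-suc≡T⇒< (suc L) c e′) ⟩
          reach (suc L)              ≡⟨ cong (_⊓ T) (next-unmarked m) ⟩
          reach L                    ∎
          where open ≡-Reasoning
      sweep-inside-suc c L e b<L {y} (inj₁ L<y) y<T = above (marked (suc L))
        where
        L≤T = <⇒≤ (+-suc≡T⇒< L (suc c) e)
        b<y = <-trans b<L L<y
        ih = sweep-inside c (suc L) (+-suc-≡ e) (m≤n⇒m≤1+n b<L) L<y y<T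

        above : ∀ β → (if β then push L ∘ sweep c (suc L) else sweep c (suc L) ∘ push L) y ≡ reach y
        above true  = trans (cong (push L) ih)
          (push-miss b<L L≤T (<-trans b<y (<-reach y<T)) (reach-≤ y) (>⇒≢ (<-trans L<y (<-reach y<T))))
        above false = trans (cong (sweep c (suc L)) (push-miss b<L L≤T b<y (<⇒≤ y<T) (>⇒≢ L<y))) ih

      push-T-reach : ∀ {y} → b < y → y < T → push T (reach y) ≡ next (suc y)
      push-T-reach {y} b<y y<T with next (suc y) <? T
      ... | yes z<T = begin
        push T (next (suc y) ⊓ T) ≡⟨ cong (push T) (m≤n⇒m⊓n≡m (<⇒≤ z<T)) ⟩
        push T (next (suc y))     ≡⟨ push-miss b<T ≤-refl (<-trans b<y (≤-next (suc y))) (<⇒≤ z<T) (<⇒≢ z<T) ⟩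
        next (suc y)              ∎
        where
        open ≡-Reasoning
        b<T = m<m+n b (>-nonZero⁻¹ n)
      ... | no  z≮T = begin
        push T (next (suc y) ⊓ T) ≡⟨ cong (push T) (m≥n⇒m⊓n≡n T≤z) ⟩
        push T T                  ≡⟨ push-hit T ⟩
        suc T                     ≡⟨ next-unique (s≤s (<⇒≤ y<T)) mT+1 rank≡ ⟨
        next (suc y)              ∎
        where
        open ≡-Reasoning
        T≤z = ≮⇒≥ z≮T
        rank≡ : rank (suc T) ≡ rank (suc y)
        rank≡ = trans (rank-unmarked {T} mT) (≤-antisym
          (≤-trans (rank-mono T≤z) (≤-reflexive (rank-next (suc y)))) (rank-mono y<T))

      sweep-start : suc b + suc n-2 ≡ T
      sweep-start = sym (+-suc b (suc n-2))

      advance-lift : ℕ → ℕ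
      advance-lift = push T ∘ sweep n-2 (suc b)

      advance-lift-spec : ∀ {y} → b < y → y ≤ T → advance-lift y ≡ next (suc y)
      advance-lift-spec {y} b<y y≤T with m≤n⇒m<n∨m≡n y≤T
      ... | inj₁ y<T = trans (cong (push T) (sweep-inside n-2 (suc b) sweep-start (n<1+n b) b<y y<T))
                             (push-T-reach b<y y<T)
      ... | inj₂ refl = begin
        push T (sweep n-2 (suc b) T) ≡⟨ cong (push T) (sweep-outside n-2 (suc b) sweep-start (n<1+n b) b<y (inj₂ refl)) ⟩
        push T T                     ≡⟨ push-hit T ⟩
        suc T                        ≡⟨ next-marked mT+1 ⟨
        next (suc T)                 ∎
        where open ≡-Reasoning

      advance : Fin n → Fin n
      advance x = next (suc (toℕ x)) mod n

      advance∈S : InS n advance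
      advance∈S with FlowLift-∘ {sweep n-2 (suc b)} {push T} (sweep-flow n-2 (suc b)) (push-flow T)
      ... | g , g∈ , lift↓g = g , g∈ , g≗advance
        where
        g-at : ∀ {y} → b < y → y ≤ T → g (y mod n) ≡ next (suc y) mod n
        g-at {y} b<y y≤T = trans (sym (lift↓g y)) (cong (_mod n) (advance-lift-spec b<y y≤T))

        g≗advance : ∀ x → g x ≡ advance x
        g≗advance x with toℕ x ≤? b
        ... | no  x≰b = trans (cong g (sym (toℕ-mod-cancel x)))
                              (g-at (≰⇒> x≰b) (≤-trans (<⇒≤ (toℕ<n x)) (m≤n+m n b)))
        ... | yes x≤b = begin
          g x                            ≡⟨ cong g (trans (mod-+n (toℕ x)) (toℕ-mod-cancel x)) ⟨
          g ((toℕ x + n) mod n)          ≡⟨ g-at (<-≤-trans b<n (m≤n+m n (toℕ x))) (+-monoˡ-≤ n x≤b) ⟩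
          next (suc (toℕ x) + n) mod n   ≡⟨ cong (_mod n) (next-shift (suc (toℕ x))) ⟩
          (next (suc (toℕ x)) + n) mod n ≡⟨ mod-+n (next (suc (toℕ x))) ⟩
          advance x                      ∎
          where open ≡-Reasoning

      advance-∈ : ∀ x → advance x ∈ W
      advance-∈ x = marked⇒mod∈ (next (suc (toℕ x))) (marked-next (suc (toℕ x)))

      advance≈rotate-1 : advance ≈[ W ] rotate 1
      advance≈rotate-1 x x∈W = cong (_mod n) (begin
        next (suc (toℕ x))               ≡⟨ cong (next ∘ suc) (enum-rank (∈⇒marked x∈W)) ⟨
        next (suc (enum (rank (toℕ x)))) ≡⟨ cong enum (+-comm (rank (toℕ x)) 1) ⟨
        enum (rank (toℕ x) + 1)          ∎)
        where open ≡-Reasoning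

      advance-admissible : Admissible Vk advance
      advance-admissible = advance∈S , (λ x _ → advance-∈ x) , onto , (λ x _ → advance-∈ x)
        where
        onto : ∀ y → y ∈ W → ∃ λ x → x ∈ W × advance x ≡ y
        onto y y∈W = rotate (pred m) y , rotate-∈ (pred m) y , (begin
          advance (rotate (pred m) y)  ≡⟨ advance≈rotate-1 _ (rotate-∈ (pred m) y) ⟩
          rotate 1 (rotate (pred m) y) ≡⟨ rotate-+ (pred m) 1 y ⟩
          rotate (pred m + 1) y        ≡⟨ cong (λ r → rotate r y) pred-m+1≡1*m ⟩
          rotate (1 * m) y             ≡⟨ rotate-*m 1 y∈W ⟩
          y                            ∎)
          where
          open ≡-Reasoning
          pred-m+1≡1*m : pred m + 1 ≡ 1 * m
          pred-m+1≡1*m = trans (+-comm (pred m) 1) (trans (suc-pred m) (sym (*-identityˡ m)))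

    rotate-closed : ∀ {f} a → DefectGroup n Vk f → f ≈[ W ] rotate a → DefectGroup n Vk (rotate a)
    rotate-closed a f∈G f≈ = inv (inv f∈G (InverseOn-congˡ f≈ (rotate-inverse a)))
                                 (InverseOn-sym (λ x _ → rotate-∈ a x) (rotate-inverse a))

    defect⇒rotation : ∀ {g} → DefectGroup n Vk g → ∃ λ r → g ≈[ W ] rotate r
    defect⇒rotation one         = 0 , λ x x∈W → sym (rotate-0 x∈W)
    defect⇒rotation (gen s-adm) = admissible⇒rotation s-adm
    defect⇒rotation (comp {g = g} f∈G g∈G) with defect⇒rotation f∈G | defect⇒rotation g∈G
    ... | a , f≈ | c , g≈ = a + c , λ x x∈W →
      trans (cong g (f≈ x x∈W)) (trans (g≈ (rotate a x) (rotate-∈ a x)) (rotate-+ a c x))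
    defect⇒rotation (inv {f} {g} f∈G (_ , g∘f≈id , _)) with defect⇒rotation f∈G
    ... | a , f≈ = a * pred m , λ x x∈W → begin
      g x                              ≡⟨ cong g (rotate-a∘rotate-a⁻¹ x x∈W) ⟨
      g (rotate a (rotate a⁻¹ x))      ≡⟨ cong g (f≈ (rotate a⁻¹ x) (rotate-∈ a⁻¹ x)) ⟨
      g (f (rotate a⁻¹ x))             ≡⟨ g∘f≈id (rotate a⁻¹ x) (rotate-∈ a⁻¹ x) ⟩
      rotate a⁻¹ x                     ∎
      where
      open ≡-Reasoning
      a⁻¹ = a * pred m
      rotate-a∘rotate-a⁻¹ = proj₂ (proj₂ (rotate-inverse a))

    rotation∈defect : Nonempty Vk → ∀ r → DefectGroup n Vk (rotate r)
    rotation∈defect (v , v∈Vk)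
      with unmarked-before-marked {toℕ v} (∉⇒unmarked {v} (λ v∈W → x∈∁p⇒x∉p v∈W v∈Vk))
    ... | b , b<n , mb , mb+1 = rotation∈
      where
      open Advance b b<n mb mb+1

      rotate-1∈ : DefectGroup n Vk (rotate 1)
      rotate-1∈ = rotate-closed 1 (gen advance-admissible) advance≈rotate-1

      rotation∈ : ∀ r → DefectGroup n Vk (rotate r)
      rotation∈ zero    = rotate-closed 0 one (λ x x∈W → sym (rotate-0 x∈W))
      rotation∈ (suc r) = rotate-closed (suc r) (comp (rotation∈ r) rotate-1∈)
        (λ x _ → trans (rotate-+ r 1 x) (cong (λ s → rotate s x) (+-comm r 1)))

    defect≅ℤ : Nonempty Vk → ∀ M → m ≡ suc M → IsoToCyclic n Vk (suc M)
    defect≅ℤ nonempty M m≡ =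
      φ , (λ i → rotation∈defect nonempty (toℕ i)) , injective , surjective , homomorphic
      where
      φ : Fin (suc M) → Fin n → Fin n
      φ i = rotate (toℕ i)

      rotate-mod-suc-M : ∀ r → rotate (toℕ (r mod suc M)) ≈[ W ] rotate r
      rotate-mod-suc-M r x _ = trans (cong (λ s → rotate s x) (trans (toℕ-mod r (suc M)) (%-congʳ (sym m≡))))
                                     (rotate-% r x)

      toℕ<m : ∀ (i : Fin (suc M)) → toℕ i < m
      toℕ<m i = subst (toℕ i <_) (sym m≡) (toℕ<n i)

      injective : ∀ i j → φ i ≈[ W ] φ j → i ≡ j
      injective i j φi≈φj = toℕ-injective (rotate-injective (toℕ<m i) (toℕ<m j) φi≈φj)

      surjective : ∀ g → DefectGroup n Vk g → ∃ λ i → φ i ≈[ W ] g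
      surjective g g∈G with defect⇒rotation g∈G
      ... | r , g≈ = r mod suc M , λ x x∈W → trans (rotate-mod-suc-M r x x∈W) (sym (g≈ x x∈W))

      homomorphic : ∀ i j → φ (i +ₘ j) ≈[ W ] (φ j ∘ φ i)
      homomorphic i j x x∈W = trans (rotate-mod-suc-M (toℕ i + toℕ j) x x∈W)
                                    (sym (rotate-+ (toℕ i) (toℕ j) x))

∣p∣>0⇒Nonempty : ∀ {N} (p : Subset N) → 0 < ∣ p ∣ → Nonempty p
∣p∣>0⇒Nonempty {N} p 0<∣p∣ with nonempty? p
... | yes p≢∅ = p≢∅
... | no  p≡∅ = contradiction (trans (cong ∣_∣ (Empty-unique p≡∅)) (∣⊥∣≡0 N)) (>⇒≢ 0<∣p∣)

lemma3p3 : (n k : ℕ) → 3 ≤ n → 1 ≤ k → k ≤ n ∸ 1 →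
    (Vk : Subset n) → ∣ Vk ∣ ≡ k → IsoToCyclic n Vk (n ∸ k)
lemma3p3 (suc (suc n-2)) k (s≤s (s≤s _)) 1≤k k≤n-1 Vk ∣Vk∣≡k =
  subst (IsoToCyclic n Vk) (sym n∸k≡1+M) (defect≅ℤ Vk≢∅ M m≡1+M)
  where
  open Cycle n-2 Vk

  M : ℕ
  M = pred (n ∸ k)

  n∸k≡1+M : n ∸ k ≡ suc M
  n∸k≡1+M = sym (suc-pred (n ∸ k) ⦃ >-nonZero (m<n⇒0<n∸m (s≤s k≤n-1)) ⦄)

  m≡1+M : m ≡ suc M
  m≡1+M = trans m≡∣W∣ (trans (∣∁p∣≡n∸∣p∣ Vk) (trans (cong (n ∸_) ∣Vk∣≡k) n∸k≡1+M))

  instance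
    m≢0 : NonZero m
    m≢0 = subst NonZero (sym m≡1+M) _

  open Defect

  Vk≢∅ : Nonempty Vk
  Vk≢∅ = ∣p∣>0⇒Nonempty Vk (subst (0 <_) (sym ∣Vk∣≡k) 1≤k)
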